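{- Let $T$ be a min-max tree with root $r_T$. Then for every edge $e$ of $T$, the branch $T_e$ of $T$ rooted at $e$ satisfies $d_T(T_e)\ge d(T)$, with strict inequality whenever $T\ne T_e$.
   Context: Consider a finite tree $T=(V_T,E_T)$ with edge costs $c(e)>0$, vertex prizes $p(v)\ge 0$ and a designated root $r_T$. For a subgraph $S$, $p(S)$ and $c(S)$ denote total prize and total cost; $d(S)=p(S)/c(S)$ when $c(S)>0$. $T$ is a min-max tree with root $r_T$ if $p(r_T)=0$ and every proper subtree $T'\subsetneq T$ containing $r_T$ with $c(T')>0$ satisfies $d(T)>d(T')$. For an edge $e$ of $T$, the branch $T_e$ is the subtree of $T$ induced by the endpoints of $e$ and all vertices $u$ such that $e$ lies on the $r_T$-$u$ path in $T$. For a subtree $S$ of $T$ with an edge, $r_S$ is its vertex closest to $r_T$ and $d_T(S)=(p(S)-p(r_S))/c(S)$.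
   Formalization: The edge costs and vertex prizes take values in the rationals rather than the reals. -}

module Defs where

open import Data.Nat using (ℕ; zero; suc)
open import Data.Fin using (Fin; zero; suc; toℕ)
open import Data.Fin.Subset using (Subset; _∈_; ⊤)
open import Data.Vec using (lookup)
open import Data.Bool using (Bool; true; false; _∧_; if_then_else_)
open import Data.Rational using (ℚ; 0ℚ; _+_; _-_; _*_; _÷_; _<_; _≤_; positive)
open import Data.Rational.Properties using (pos⇒nonZero)
open import Data.Product using (_×_)
open import Data.Sum using (_⊎_)
open import Relation.Binary.PropositionalEquality using (_≡_; _≢_)

Σ : ∀ {m} → (Fin m → ℚ) → ℚ
Σ {zero}  f = 0ℚ
Σ {suc m} f = f zero + Σ (λ i → f (suc i))

_÷⁺_⟨_⟩ : ℚ → (y : ℚ) → 0ℚ < y → ℚ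
x ÷⁺ y ⟨ h ⟩ = _÷_ x y {{pos⇒nonZero y {{positive h}}}}

-- A finite rooted tree with n edges and suc n vertices (Fin (suc n)),
-- root = zero.  Vertex (suc i) has parent (parent i), with a smaller
-- index; the edge number i joins (parent i) and (suc i).  Every finite
-- rooted tree can be so labelled (e.g. in BFS order).
record RootedTree (n : ℕ) : Set where
  field
    parent    : Fin n → Fin (suc n)
    parent<   : ∀ i → toℕ (parent i) Data.Nat.≤ toℕ i
    cost      : Fin n → ℚ
    cost-pos  : ∀ i → 0ℚ < cost i
    prize     : Fin (suc n) → ℚ
    prize-nn  : ∀ v → 0ℚ ≤ prize v

module _ {n : ℕ} (T : RootedTree n) where
  open RootedTree T

  root : Fin (suc n)
  root = zero

  data _≼_ (a : Fin (suc n)) : Fin (suc n) → Set where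
    here : a ≼ a
    step : ∀ j → a ≼ parent j → a ≼ suc j

  -- Subgraphs are given by vertex sets; their edges are all tree edges
  -- with both endpoints in the set (induced subgraph).
  inS : Subset (suc n) → Fin (suc n) → Bool
  inS S v = lookup S v

  prizeOf : Subset (suc n) → ℚ
  prizeOf S = Σ (λ v → if inS S v then prize v else 0ℚ)

  costOf : Subset (suc n) → ℚ
  costOf S = Σ (λ i → if inS S (suc i) ∧ inS S (parent i) then cost i else 0ℚ)

  -- Subtrees containing the root r_T: connected subgraphs containing the
  -- root, i.e. vertex sets containing the root and closed under parent.
  IsRootSubtree : Subset (suc n) → Set
  IsRootSubtree S = (root ∈ S) × (∀ i → suc i ∈ S → parent i ∈ S)

  d : (S : Subset (suc n)) → 0ℚ < costOf S → ℚ
  d S h = prizeOf S ÷⁺ costOf S ⟨ h ⟩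

  IsMinMax : Set
  IsMinMax = (prize root ≡ 0ℚ)
           × (∀ (S : Subset (suc n)) → IsRootSubtree S → S ≢ ⊤
              → (hS : 0ℚ < costOf S) (hT : 0ℚ < costOf ⊤) → d S hS < d ⊤ hT)

  -- B is (the vertex set of) the branch T_e for the edge e = edge i:
  -- endpoints of e together with all u such that e lies on the r_T–u path.
  IsBranch : Fin n → Subset (suc n) → Set
  IsBranch i B = ∀ u → (u ∈ B → (u ≡ parent i ⊎ (suc i ≼ u)))
                     × ((u ≡ parent i ⊎ (suc i ≼ u)) → u ∈ B)

  -- d_T(S) = (p(S) - p(r_S))/c(S); for the branch of edge i, r_S = parent i.
  dT-branch : Fin n → (B : Subset (suc n)) → 0ℚ < costOf B → ℚ
  dT-branch i B h = (prizeOf B - prize (parent i)) ÷⁺ costOf B ⟨ h ⟩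

{-# OPTIONS --safe #-}
-- Cut T at the edge e into the branch B = T_e and the trunk S: T without B, except
-- that S keeps the root r_B of B.  S is a subtree containing r_T, S ≠ T,
-- c(T) = c(S) + c(B) and p(T) + p(r_B) = p(S) + p(B).  Since T is min-max,
-- p(S) ≤ d(T) c(S), strictly if c(S) > 0 (if c(S) = 0 then S = {r_T} and
-- p(S) = p(r_T) = 0).  Subtracting from p(T) = d(T) c(T) leaves
-- p(B) - p(r_B) ≥ d(T) c(B), strictly if c(S) > 0; and c(S) = 0 forces B = T.
module Submission where

open import Defs
open import Data.Nat using (ℕ; zero; suc; s≤s)
import Data.Nat.Properties as ℕ
open import Data.Fin using (Fin; zero; suc; toℕ; _≟_)
open import Data.Fin.Properties using (suc-injective)
open import Data.Fin.Subset using (Subset; ⊤)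
open import Data.Rational using (ℚ; 0ℚ; 1ℚ; _+_; _-_; -_; _*_; 1/_; _<_; _≤_; NonZero; positive)
import Data.Rational.Properties as ℚ
open import Data.Rational.Solver using (module +-*-Solver)
open import Data.Bool using (Bool; true; false; not; _∧_; _∨_; if_then_else_)
open import Data.Bool.Properties using (∨-inverseˡ; ∧-inverseˡ; ∧-zeroʳ; ∧-commutativeMonoid)
open import Data.Vec using (lookup; tabulate)
open import Data.Vec.Properties
  using (lookup∘tabulate; tabulate∘lookup; tabulate-cong; lookup-replicate; []=⇒lookup; lookup⇒[]=)
open import Data.Product using (_×_; _,_; proj₁; proj₂)
open import Data.Sum using (_⊎_; inj₁; inj₂; [_,_]′)
open import Data.Empty using (⊥-elim)
open import Function using (_∘_; id)
open import Algebra.Bundles using (CommutativeMonoid)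
import Algebra.Properties.CommutativeSemigroup as CommSemigroupProperties
open import Relation.Nullary using (Dec; yes; no; does)
open import Relation.Nullary.Decidable using (dec-true; dec-false)
open import Relation.Binary.Definitions using (tri<; tri≈; tri>)
open import Relation.Binary.PropositionalEquality
  using (_≡_; _≢_; refl; sym; trans; cong; cong₂; subst; subst₂; module ≡-Reasoning)

open +-*-Solver using (solve; _:+_; _:-_; _:=_)
open CommSemigroupProperties (CommutativeMonoid.commutativeSemigroup ℚ.+-0-commutativeMonoid)
  using () renaming (interchange to +-interchange)
open CommSemigroupProperties (CommutativeMonoid.commutativeSemigroup ∧-commutativeMonoid)
  using () renaming (interchange to ∧-interchange)

Σ-cong : ∀ {m} {f g : Fin m → ℚ} → (∀ j → f j ≡ g j) → Σ f ≡ Σ g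
Σ-cong {zero}  f≗g = refl
Σ-cong {suc m} f≗g = cong₂ _+_ (f≗g zero) (Σ-cong (f≗g ∘ suc))

Σ-distrib-+ : ∀ {m} (f g : Fin m → ℚ) → Σ (λ j → f j + g j) ≡ Σ f + Σ g
Σ-distrib-+ {zero}  f g = refl
Σ-distrib-+ {suc m} f g =
  trans (cong (f zero + g zero +_) (Σ-distrib-+ (f ∘ suc) (g ∘ suc)))
        (+-interchange (f zero) (g zero) (Σ (f ∘ suc)) (Σ (g ∘ suc)))

Σ-0 : ∀ m → Σ {m} (λ _ → 0ℚ) ≡ 0ℚ
Σ-0 zero    = refl
Σ-0 (suc m) = cong (0ℚ +_) (Σ-0 m)

Σ-nonneg : ∀ {m} {f : Fin m → ℚ} → (∀ j → 0ℚ ≤ f j) → 0ℚ ≤ Σ f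
Σ-nonneg {zero}  f≥0 = ℚ.≤-refl
Σ-nonneg {suc m} f≥0 = ℚ.+-mono-≤ (f≥0 zero) (Σ-nonneg (f≥0 ∘ suc))

term≤Σ : ∀ {m} {f : Fin m → ℚ} → (∀ j → 0ℚ ≤ f j) → ∀ k → f k ≤ Σ f
term≤Σ {suc m} {f} f≥0 zero = begin
  f zero                     ≡⟨ ℚ.+-identityʳ (f zero) ⟨
  f zero + 0ℚ                ≤⟨ ℚ.+-monoʳ-≤ (f zero) (Σ-nonneg (f≥0 ∘ suc)) ⟩
  f zero + Σ (f ∘ suc)       ∎
  where open ℚ.≤-Reasoning
term≤Σ {suc m} {f} f≥0 (suc k) = begin
  f (suc k)                  ≡⟨ ℚ.+-identityˡ (f (suc k)) ⟨
  0ℚ + f (suc k)             ≤⟨ ℚ.+-mono-≤ (f≥0 zero) (term≤Σ (f≥0 ∘ suc) k) ⟩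
  f zero + Σ (f ∘ suc)       ∎
  where open ℚ.≤-Reasoning

-- prizeOf and costOf are definitionally sums of restricted functions.
restrict : ∀ {m} → (Fin m → Bool) → (Fin m → ℚ) → Fin m → ℚ
restrict a f j = if a j then f j else 0ℚ

module _ {m : ℕ} (f : Fin m → ℚ) where

  Σ-restrict-all : ∀ {a} → (∀ j → a j ≡ true) → Σ (restrict a f) ≡ Σ f
  Σ-restrict-all a≡true = Σ-cong λ j → cong (λ b → if b then f j else 0ℚ) (a≡true j)

  Σ-restrict-none : ∀ {a} → (∀ j → a j ≡ false) → Σ (restrict a f) ≡ 0ℚ
  Σ-restrict-none a≡false =
    trans (Σ-cong λ j → cong (λ b → if b then f j else 0ℚ) (a≡false j)) (Σ-0 m)

  Σ-restrict-∨-∧ : ∀ a b →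
    Σ (restrict a f) + Σ (restrict b f) ≡
    Σ (restrict (λ j → a j ∨ b j) f) + Σ (restrict (λ j → a j ∧ b j) f)
  Σ-restrict-∨-∧ a b = begin
    Σ (restrict a f) + Σ (restrict b f)                 ≡⟨ Σ-distrib-+ (restrict a f) (restrict b f) ⟨
    Σ (λ j → restrict a f j + restrict b f j)           ≡⟨ Σ-cong (λ j → inclusion-exclusion (a j) (b j) (f j)) ⟩
    Σ (λ j → restrict ∨ab f j + restrict ∧ab f j)       ≡⟨ Σ-distrib-+ (restrict ∨ab f) (restrict ∧ab f) ⟩
    Σ (restrict ∨ab f) + Σ (restrict ∧ab f)             ∎
    where
    open ≡-Reasoning
    ∨ab ∧ab : Fin m → Bool
    ∨ab j = a j ∨ b j
    ∧ab j = a j ∧ b j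
    inclusion-exclusion : ∀ s t x →
      (if s then x else 0ℚ) + (if t then x else 0ℚ) ≡
      (if s ∨ t then x else 0ℚ) + (if s ∧ t then x else 0ℚ)
    inclusion-exclusion true  true  x = refl
    inclusion-exclusion true  false x = refl
    inclusion-exclusion false true  x = ℚ.+-comm 0ℚ x
    inclusion-exclusion false false x = refl

restrict-nonneg : ∀ {m} a {f : Fin m → ℚ} → (∀ j → 0ℚ ≤ f j) → ∀ j → 0ℚ ≤ restrict a f j
restrict-nonneg a f≥0 j with a j
... | true  = f≥0 j
... | false = ℚ.≤-refl

Σ-restrict-single : ∀ {m} (f : Fin m → ℚ) {a} k → a k ≡ true → (∀ j → j ≢ k → a j ≡ false) →
                    Σ (restrict a f) ≡ f k
Σ-restrict-single {suc m} f {a} zero ak only-k = begin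
  restrict a f zero + Σ (restrict (a ∘ suc) (f ∘ suc))  ≡⟨ cong₂ _+_ head tail ⟩
  f zero + 0ℚ                                           ≡⟨ ℚ.+-identityʳ (f zero) ⟩
  f zero                                                ∎
  where
  open ≡-Reasoning
  head : restrict a f zero ≡ f zero
  head rewrite ak = refl
  tail : Σ (restrict (a ∘ suc) (f ∘ suc)) ≡ 0ℚ
  tail = Σ-restrict-none (f ∘ suc) (λ j → only-k (suc j) λ ())
Σ-restrict-single {suc m} f {a} (suc k) ak only-k = begin
  restrict a f zero + Σ (restrict (a ∘ suc) (f ∘ suc))  ≡⟨ cong₂ _+_ head tail ⟩
  0ℚ + f (suc k)                                        ≡⟨ ℚ.+-identityˡ (f (suc k)) ⟩
  f (suc k)                                             ∎
  where
  open ≡-Reasoning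
  head : restrict a f zero ≡ 0ℚ
  head rewrite only-k zero (λ ()) = refl
  tail : Σ (restrict (a ∘ suc) (f ∘ suc)) ≡ f (suc k)
  tail = Σ-restrict-single (f ∘ suc) k ak (λ j j≢k → only-k (suc j) (j≢k ∘ suc-injective))

÷⁺-*-cancel : ∀ x y (y>0 : 0ℚ < y) → (x ÷⁺ y ⟨ y>0 ⟩) * y ≡ x
÷⁺-*-cancel x y y>0 = begin
  x * (1/ y) * y   ≡⟨ ℚ.*-assoc x (1/ y) y ⟩
  x * (1/ y * y)   ≡⟨ cong (x *_) (ℚ.*-inverseˡ y) ⟩
  x * 1ℚ           ≡⟨ ℚ.*-identityʳ x ⟩
  x                ∎
  where
  open ≡-Reasoning
  instance
    y≢0 : NonZero y
    y≢0 = ℚ.pos⇒nonZero y {{positive y>0}}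

module _ {x y a : ℚ} (y>0 : 0ℚ < y) where

  *-≤⇒≤-÷⁺ : a * y ≤ x → a ≤ x ÷⁺ y ⟨ y>0 ⟩
  *-≤⇒≤-÷⁺ ay≤x = ℚ.*-cancelʳ-≤-pos y {{positive y>0}}
    (subst (a * y ≤_) (sym (÷⁺-*-cancel x y y>0)) ay≤x)

  *-<⇒<-÷⁺ : a * y < x → a < x ÷⁺ y ⟨ y>0 ⟩
  *-<⇒<-÷⁺ ay<x = ℚ.*-cancelʳ-<-nonNeg y {{ℚ.pos⇒nonNeg y {{positive y>0}}}}
    (subst (a * y <_) (sym (÷⁺-*-cancel x y y>0)) ay<x)

  ÷⁺-<⇒<-* : x ÷⁺ y ⟨ y>0 ⟩ < a → x < a * y
  ÷⁺-<⇒<-* x/y<a = subst (_< a * y) (÷⁺-*-cancel x y y>0) (ℚ.*-monoˡ-<-pos y {{positive y>0}} x/y<a)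

module _ {x y x′ y′ : ℚ} (sum≡ : x + y ≡ x′ + y′) where

  private
    y′≡ : y′ ≡ (x + y) - x′
    y′≡ = trans (solve 2 (λ x′ y′ → y′ := (x′ :+ y′) :- x′) refl x′ y′) (cong (_- x′) (sym sum≡))
    ≡y : (x′ + y) - x′ ≡ y
    ≡y = solve 2 (λ x′ y → (x′ :+ y) :- x′ := y) refl x′ y

  +≡+∧≤⇒≥ : x ≤ x′ → y′ ≤ y
  +≡+∧≤⇒≥ x≤x′ = subst₂ _≤_ (sym y′≡) ≡y (ℚ.+-monoˡ-≤ (- x′) (ℚ.+-monoˡ-≤ y x≤x′))

  +≡+∧<⇒> : x < x′ → y′ < y
  +≡+∧<⇒> x<x′ = subst₂ _<_ (sym y′≡) ≡y (ℚ.+-monoˡ-< (- x′) (ℚ.+-monoˡ-< y x<x′))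

module _ {P C pS cS pB cB r : ℚ} (C>0 : 0ℚ < C) (cB>0 : 0ℚ < cB)
         (C≡ : C ≡ cS + cB) (P≡ : P + r ≡ pS + pB) where

  private
    split : pS + (pB - r) ≡ (P ÷⁺ C ⟨ C>0 ⟩) * cS + (P ÷⁺ C ⟨ C>0 ⟩) * cB
    split = begin
      pS + (pB - r)    ≡⟨ solve 3 (λ pS pB r → pS :+ (pB :- r) := (pS :+ pB) :- r) refl pS pB r ⟩
      (pS + pB) - r    ≡⟨ cong (_- r) P≡ ⟨
      (P + r) - r      ≡⟨ solve 2 (λ P r → (P :+ r) :- r := P) refl P r ⟩
      P                ≡⟨ ÷⁺-*-cancel P C C>0 ⟨
      a * C            ≡⟨ cong (a *_) C≡ ⟩
      a * (cS + cB)    ≡⟨ ℚ.*-distribˡ-+ a cS cB ⟩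
      a * cS + a * cB  ∎
      where
      open ≡-Reasoning
      a : ℚ
      a = P ÷⁺ C ⟨ C>0 ⟩

  remainder-ratio-≥ : pS ≤ (P ÷⁺ C ⟨ C>0 ⟩) * cS → P ÷⁺ C ⟨ C>0 ⟩ ≤ (pB - r) ÷⁺ cB ⟨ cB>0 ⟩
  remainder-ratio-≥ = *-≤⇒≤-÷⁺ cB>0 ∘ +≡+∧≤⇒≥ split

  remainder-ratio-> : pS < (P ÷⁺ C ⟨ C>0 ⟩) * cS → P ÷⁺ C ⟨ C>0 ⟩ < (pB - r) ÷⁺ cB ⟨ cB>0 ⟩
  remainder-ratio-> = *-<⇒<-÷⁺ cB>0 ∘ +≡+∧<⇒> split

module _ {n : ℕ} (T : RootedTree n) where
  open RootedTree T

  edgeIn : Subset (suc n) → Fin n → Bool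
  edgeIn S j = inS T S (suc j) ∧ inS T S (parent j)

  ≼⇒toℕ≤ : ∀ {a u} → _≼_ T a u → toℕ a Data.Nat.≤ toℕ u
  ≼⇒toℕ≤ here          = ℕ.≤-refl
  ≼⇒toℕ≤ (step j a≼pj) = ℕ.≤-trans (≼⇒toℕ≤ a≼pj) (ℕ.m≤n⇒m≤1+n (parent< j))

  parent≢suc : ∀ j → parent j ≢ suc j
  parent≢suc j pj≡sj = ℕ.<⇒≢ (s≤s (parent< j)) (cong toℕ pj≡sj)

  inS-⊤ : ∀ v → inS T ⊤ v ≡ true
  inS-⊤ v = lookup-replicate v true

  all-inS⇒≡⊤ : ∀ {S} → (∀ v → inS T S v ≡ true) → S ≡ ⊤
  all-inS⇒≡⊤ {S} all = begin
    S                  ≡⟨ tabulate∘lookup S ⟨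
    tabulate (inS T S) ≡⟨ tabulate-cong (λ v → trans (all v) (sym (inS-⊤ v))) ⟩
    tabulate (inS T ⊤) ≡⟨ tabulate∘lookup ⊤ ⟩
    ⊤                  ∎
    where open ≡-Reasoning

  costOf-nonneg : ∀ S → 0ℚ ≤ costOf T S
  costOf-nonneg S = Σ-nonneg (restrict-nonneg (edgeIn S) (ℚ.<⇒≤ ∘ cost-pos))

  costOf-pos-or-zero : ∀ S → 0ℚ < costOf T S ⊎ costOf T S ≡ 0ℚ
  costOf-pos-or-zero S with ℚ.<-cmp 0ℚ (costOf T S)
  ... | tri< c>0 _ _ = inj₁ c>0
  ... | tri≈ _ 0≡c _ = inj₂ (sym 0≡c)
  ... | tri> _ _ c<0 = ⊥-elim (ℚ.<-irrefl refl (ℚ.<-≤-trans c<0 (costOf-nonneg S)))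

  cost≤costOf : ∀ {S} j → edgeIn S j ≡ true → cost j ≤ costOf T S
  cost≤costOf {S} j j∈S =
    subst (_≤ costOf T S) restricted (term≤Σ (restrict-nonneg (edgeIn S) (ℚ.<⇒≤ ∘ cost-pos)) j)
    where
    restricted : restrict (edgeIn S) cost j ≡ cost j
    restricted rewrite j∈S = refl

  costOf-split : ∀ {S B} → (∀ j → edgeIn S j ∨ edgeIn B j ≡ true) → (∀ j → edgeIn S j ∧ edgeIn B j ≡ false) →
                 costOf T ⊤ ≡ costOf T S + costOf T B
  costOf-split {S} {B} cover disjoint = begin
    costOf T ⊤                      ≡⟨ Σ-restrict-all cost (λ j → cong₂ _∧_ (inS-⊤ (suc j)) (inS-⊤ (parent j))) ⟩
    Σ cost                          ≡⟨ Σ-restrict-all cost cover ⟨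
    inEither                        ≡⟨ ℚ.+-identityʳ inEither ⟨
    inEither + 0ℚ                   ≡⟨ cong (inEither +_) (Σ-restrict-none cost disjoint) ⟨
    inEither + inBoth               ≡⟨ Σ-restrict-∨-∧ cost (edgeIn S) (edgeIn B) ⟨
    costOf T S + costOf T B         ∎
    where
    open ≡-Reasoning
    inEither inBoth : ℚ
    inEither = Σ (restrict (λ j → edgeIn S j ∨ edgeIn B j) cost)
    inBoth   = Σ (restrict (λ j → edgeIn S j ∧ edgeIn B j) cost)

  prizeOf-split : ∀ {S B} k → (∀ v → inS T S v ∨ inS T B v ≡ true) →
                  inS T S k ∧ inS T B k ≡ true → (∀ v → v ≢ k → inS T S v ∧ inS T B v ≡ false) →
                  prizeOf T ⊤ + prize k ≡ prizeOf T S + prizeOf T B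
  prizeOf-split {S} {B} k cover k∈S∩B only-k = begin
    prizeOf T ⊤ + prize k           ≡⟨ cong₂ _+_ (Σ-restrict-all prize inS-⊤) (sym (Σ-restrict-single prize k k∈S∩B only-k)) ⟩
    Σ prize + inBoth                ≡⟨ cong (_+ inBoth) (Σ-restrict-all prize cover) ⟨
    inEither + inBoth               ≡⟨ Σ-restrict-∨-∧ prize (inS T S) (inS T B) ⟨
    prizeOf T S + prizeOf T B       ∎
    where
    open ≡-Reasoning
    inEither inBoth : ℚ
    inEither = Σ (restrict (λ v → inS T S v ∨ inS T B v) prize)
    inBoth   = Σ (restrict (λ v → inS T S v ∧ inS T B v) prize)

  -- An edge has two distinct endpoints, so it cannot lie in two sets meeting in one vertex.
  edgeIn-disjoint : ∀ {S B} k → (∀ v → v ≢ k → inS T S v ∧ inS T B v ≡ false) →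
                    ∀ j → edgeIn S j ∧ edgeIn B j ≡ false
  edgeIn-disjoint {S} {B} k only-k j = trans (∧-interchange s-sj s-pj b-sj b-pj) (endpoint-outside (suc j ≟ k))
    where
    s-sj s-pj b-sj b-pj : Bool
    s-sj = inS T S (suc j)
    s-pj = inS T S (parent j)
    b-sj = inS T B (suc j)
    b-pj = inS T B (parent j)
    endpoint-outside : Dec (suc j ≡ k) → (s-sj ∧ b-sj) ∧ (s-pj ∧ b-pj) ≡ false
    endpoint-outside (no sj≢k)  = cong (_∧ (s-pj ∧ b-pj)) (only-k (suc j) sj≢k)
    endpoint-outside (yes sj≡k) = trans (cong ((s-sj ∧ b-sj) ∧_) (only-k (parent j) pj≢k)) (∧-zeroʳ (s-sj ∧ b-sj))
      where
      pj≢k : parent j ≢ k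
      pj≢k pj≡k = parent≢suc j (trans pj≡k (sym sj≡k))

  zero-cost⇒root-only : ∀ {S} → IsRootSubtree T S → costOf T S ≡ 0ℚ → ∀ j → inS T S (suc j) ≡ false
  zero-cost⇒root-only {S} (_ , closed) c≡0 j with inS T S (suc j) in sj∈S
  ... | false = refl
  ... | true  = ⊥-elim (ℚ.<-irrefl refl (begin-strict
    0ℚ         <⟨ cost-pos j ⟩
    cost j     ≤⟨ cost≤costOf {S} j j∈S ⟩
    costOf T S ≡⟨ c≡0 ⟩
    0ℚ         ∎))
    where
    open ℚ.≤-Reasoning
    j∈S : edgeIn S j ≡ true
    j∈S rewrite sj∈S | []=⇒lookup (closed j (lookup⇒[]= (suc j) S sj∈S)) = refl

  root-only⇒prizeOf≡0 : ∀ {S} → prize (root T) ≡ 0ℚ → (∀ j → inS T S (suc j) ≡ false) → prizeOf T S ≡ 0ℚ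
  root-only⇒prizeOf≡0 {S} root≡0 root-only = cong₂ _+_ at-root (Σ-restrict-none (prize ∘ suc) root-only)
    where
    at-root : restrict (inS T S) prize zero ≡ 0ℚ
    at-root with inS T S zero
    ... | true  = root≡0
    ... | false = refl

  module _ (minmax : IsMinMax T) (T>0 : 0ℚ < costOf T ⊤) {S} (S-subtree : IsRootSubtree T S) (S≢⊤ : S ≢ ⊤) where

    prizeOf<d*costOf : 0ℚ < costOf T S → prizeOf T S < d T ⊤ T>0 * costOf T S
    prizeOf<d*costOf S>0 = ÷⁺-<⇒<-* S>0 (proj₂ minmax S S-subtree S≢⊤ S>0 T>0)

    prizeOf≤d*costOf : prizeOf T S ≤ d T ⊤ T>0 * costOf T S
    prizeOf≤d*costOf with costOf-pos-or-zero S
    ... | inj₁ S>0 = ℚ.<⇒≤ (prizeOf<d*costOf S>0)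
    ... | inj₂ S≡0 = ℚ.≤-reflexive (begin
      prizeOf T S               ≡⟨ root-only⇒prizeOf≡0 {S} (proj₁ minmax) (zero-cost⇒root-only S-subtree S≡0) ⟩
      0ℚ                        ≡⟨ ℚ.*-zeroʳ (d T ⊤ T>0) ⟨
      d T ⊤ T>0 * 0ℚ            ≡⟨ cong (d T ⊤ T>0 *_) S≡0 ⟨
      d T ⊤ T>0 * costOf T S    ∎)
      where open ≡-Reasoning

module Trunk {n : ℕ} (T : RootedTree n) (i : Fin n) {B : Subset (suc n)} (branch : IsBranch T i B) where
  open RootedTree T

  Below : Fin (suc n) → Set
  Below v = _≼_ T (suc i) v

  ∈B⇒ : ∀ {v} → inS T B v ≡ true → v ≡ parent i ⊎ Below v
  ∈B⇒ {v} v∈B = proj₁ (branch v) (lookup⇒[]= v B v∈B)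

  ⇒∈B : ∀ {v} → v ≡ parent i ⊎ Below v → inS T B v ≡ true
  ⇒∈B {v} v∈T_e = []=⇒lookup (proj₂ (branch v) v∈T_e)

  below⇒≢parent : ∀ {v} → Below v → v ≢ parent i
  below⇒≢parent v-below v≡pi =
    ℕ.<⇒≢ (ℕ.<-≤-trans (s≤s (parent< i)) (≼⇒toℕ≤ T v-below)) (cong toℕ (sym v≡pi))

  below⇒edgeIn-B : ∀ {j} → Below (suc j) → edgeIn T B j ≡ true
  below⇒edgeIn-B here              = cong₂ _∧_ (⇒∈B (inj₂ here)) (⇒∈B (inj₁ refl))
  below⇒edgeIn-B (step j pj-below) = cong₂ _∧_ (⇒∈B (inj₂ (step j pj-below))) (⇒∈B (inj₂ pj-below))

  inTrunk : Fin (suc n) → Bool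
  inTrunk v = does (v ≟ parent i) ∨ not (inS T B v)

  trunk : Subset (suc n)
  trunk = tabulate inTrunk

  parent∈trunk : inS T trunk (parent i) ≡ true
  parent∈trunk = trans (lookup∘tabulate inTrunk (parent i))
                       (cong (_∨ not (inS T B (parent i))) (dec-true (parent i ≟ parent i) refl))

  trunk-off-parent : ∀ {v} → v ≢ parent i → inS T trunk v ≡ not (inS T B v)
  trunk-off-parent {v} v≢pi = trans (lookup∘tabulate inTrunk v) (cong (_∨ not (inS T B v)) (dec-false (v ≟ parent i) v≢pi))

  trunk-∨-B : ∀ v → inS T trunk v ∨ inS T B v ≡ true
  trunk-∨-B v with v ≟ parent i
  ... | yes refl  = cong (_∨ inS T B (parent i)) parent∈trunk
  ... | no v≢pi   = trans (cong (_∨ inS T B v) (trunk-off-parent v≢pi)) (∨-inverseˡ (inS T B v))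

  trunk-∧-B : ∀ v → v ≢ parent i → inS T trunk v ∧ inS T B v ≡ false
  trunk-∧-B v v≢pi = trans (cong (_∧ inS T B v) (trunk-off-parent v≢pi)) (∧-inverseˡ (inS T B v))

  parent∈trunk∩B : inS T trunk (parent i) ∧ inS T B (parent i) ≡ true
  parent∈trunk∩B = cong₂ _∧_ parent∈trunk (⇒∈B (inj₁ refl))

  below⇒∉trunk : ∀ {v} → Below v → inS T trunk v ≡ false
  below⇒∉trunk v-below = trans (trunk-off-parent (below⇒≢parent v-below)) (cong not (⇒∈B (inj₂ v-below)))

  ∉trunk⇒below : ∀ {v} → inS T trunk v ≡ false → Below v
  ∉trunk⇒below {v} v∉S with ∈B⇒ (trans (cong (_∨ inS T B v) (sym v∉S)) (trunk-∨-B v))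
  ... | inj₂ v-below = v-below
  ... | inj₁ refl with trans (sym v∉S) parent∈trunk
  ...   | ()

  trunk-closed : ∀ j → inS T trunk (suc j) ≡ true → inS T trunk (parent j) ≡ true
  trunk-closed j sj∈S with inS T trunk (parent j) in pj∈S
  ... | true  = refl
  ... | false with trans (sym sj∈S) (below⇒∉trunk (step j (∉trunk⇒below pj∈S)))
  ...   | ()

  root∈trunk : inS T trunk zero ≡ true
  root∈trunk with inS T trunk zero in r∈S
  ... | true  = refl
  ... | false with ≼⇒toℕ≤ T (∉trunk⇒below {zero} r∈S)
  ...   | ()

  trunk-subtree : IsRootSubtree T trunk
  trunk-subtree = lookup⇒[]= zero trunk root∈trunk
                , λ j sj∈S → lookup⇒[]= (parent j) trunk (trunk-closed j ([]=⇒lookup sj∈S))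

  trunk≢⊤ : trunk ≢ ⊤
  trunk≢⊤ S≡⊤ with trans (sym (below⇒∉trunk here)) (trans (cong (λ X → inS T X (suc i)) S≡⊤) (inS-⊤ T (suc i)))
  ... | ()

  edge-cover : ∀ j → edgeIn T trunk j ∨ edgeIn T B j ≡ true
  edge-cover j with inS T trunk (suc j) in sj∈S
  ... | true rewrite trunk-closed j sj∈S = refl
  ... | false = below⇒edgeIn-B (∉trunk⇒below sj∈S)

  cost-split : costOf T ⊤ ≡ costOf T trunk + costOf T B
  cost-split = costOf-split T {trunk} {B} edge-cover (edgeIn-disjoint T {trunk} {B} (parent i) trunk-∧-B)

  prize-split : prizeOf T ⊤ + prize (parent i) ≡ prizeOf T trunk + prizeOf T B
  prize-split = prizeOf-split T {trunk} {B} (parent i) trunk-∨-B parent∈trunk∩B trunk-∧-B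

  zero-cost⇒B≡⊤ : costOf T trunk ≡ 0ℚ → B ≡ ⊤
  zero-cost⇒B≡⊤ S≡0 = all-inS⇒≡⊤ T all-in-B
    where
    root-only : ∀ j → inS T trunk (suc j) ≡ false
    root-only = zero-cost⇒root-only T trunk-subtree S≡0
    trunk-member≡root : ∀ v → inS T trunk v ≡ true → v ≡ zero
    trunk-member≡root zero    _    = refl
    trunk-member≡root (suc j) v∈S with trans (sym v∈S) (root-only j)
    ... | ()
    all-in-B : ∀ v → inS T B v ≡ true
    all-in-B zero    = ⇒∈B (inj₁ (sym (trunk-member≡root (parent i) parent∈trunk)))
    all-in-B (suc j) = trans (cong (_∨ inS T B (suc j)) (sym (root-only j))) (trunk-∨-B (suc j))

  trunk-costOf-pos : B ≢ ⊤ → 0ℚ < costOf T trunk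
  trunk-costOf-pos B≢⊤ = [ id , ⊥-elim ∘ B≢⊤ ∘ zero-cost⇒B≡⊤ ]′ (costOf-pos-or-zero T trunk)

lemma16 : ∀ {n : ℕ} (T : RootedTree n) → IsMinMax T
          → ∀ (i : Fin n) (B : Subset _) → IsBranch T i B
          → (hB : 0ℚ < costOf T B) (hT : 0ℚ < costOf T ⊤)
          → (d T ⊤ hT ≤ dT-branch T i B hB)
            × (B ≢ ⊤ → d T ⊤ hT < dT-branch T i B hB)
-- The sums over ⊤ are passed explicitly: unification unfolds ⊤ and cannot recover them.
lemma16 T minmax i B branch hB hT =
    remainder-ratio-≥ {prizeOf T ⊤} {costOf T ⊤} {prizeOf T trunk} {costOf T trunk} hT hB cost-split prize-split
      (prizeOf≤d*costOf T minmax hT trunk-subtree trunk≢⊤)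
  , λ B≢⊤ → remainder-ratio-> {prizeOf T ⊤} {costOf T ⊤} {prizeOf T trunk} {costOf T trunk} hT hB cost-split prize-split
      (prizeOf<d*costOf T minmax hT trunk-subtree trunk≢⊤ (trunk-costOf-pos B≢⊤))
  where open Trunk T i branch
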